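{- Suppose every locally compact, perfectly normal space is collectionwise Hausdorff. Then every locally compact, perfectly normal space is collectionwise normal with respect to compact sets.
   Context: A space is collectionwise Hausdorff if every closed discrete subset $D$ can be separated by a pairwise disjoint family of open sets $\{U_d : d\in D\}$ with $d\in U_d$. A space $X$ is collectionwise normal with respect to compact sets if for every discrete family $\mathcal K$ of compact subsets of $X$ there is a pairwise disjoint family of open sets $\{U_K : K\in\mathcal K\}$ with $K\subseteq U_K$ (the family $\mathcal K$ is "separated"). -}

module Defs where

open import Level using (Level; suc; _⊔_)
open import Data.Nat using (ℕ)
open import Data.Fin using (Fin)
open import Data.Product using (Σ; Σ-syntax; ∃; ∃-syntax; _×_; _,_; proj₁)
open import Data.Unit.Polymorphic using (⊤)
open import Relation.Binary.PropositionalEquality using (_≡_)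
open import Relation.Unary using (Pred; _∈_; _⊆_; _≐_; ∁; _∩_; ⋃; ⋂)

record Space (ℓ : Level) : Set (suc ℓ) where
  field
    Carrier  : Set ℓ
    IsOpen   : Pred Carrier ℓ → Set ℓ
    open-≐   : ∀ {U V : Pred Carrier ℓ} → U ≐ V → IsOpen U → IsOpen V
    open-univ : IsOpen (λ _ → ⊤)
    open-∩   : ∀ {U V : Pred Carrier ℓ} → IsOpen U → IsOpen V → IsOpen (U ∩ V)
    open-⋃   : ∀ {I : Set ℓ} (U : I → Pred Carrier ℓ) →
               (∀ i → IsOpen (U i)) → IsOpen (⋃ I U)

module _ {ℓ : Level} (X : Space ℓ) where
  open Space X

  IsClosed : Pred Carrier ℓ → Set ℓ
  IsClosed F = IsOpen (∁ F)

  T1 : Set ℓ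
  T1 = ∀ (x : Carrier) → IsClosed (λ y → y ≡ x)

  -- normal (in Engelking's sense, including T1)
  Normal : Set (suc ℓ)
  Normal = T1 × (∀ (A B : Pred Carrier ℓ) → IsClosed A → IsClosed B →
            (∀ x → x ∈ A → x ∈ B → ⊥') →
            Σ[ U ∈ Pred Carrier ℓ ] Σ[ V ∈ Pred Carrier ℓ ]
              (IsOpen U × IsOpen V × A ⊆ U × B ⊆ V × (∀ x → x ∈ U → x ∈ V → ⊥')))
    where open import Data.Empty renaming (⊥ to ⊥')

  ClosedGδ : Set (suc ℓ)
  ClosedGδ = ∀ (F : Pred Carrier ℓ) → IsClosed F →
    Σ[ U ∈ (ℕ → Pred Carrier ℓ) ] ((∀ n → IsOpen (U n)) × F ≐ ⋂ ℕ U)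

  PerfectlyNormal : Set (suc ℓ)
  PerfectlyNormal = Normal × ClosedGδ

  IsCompact : Pred Carrier ℓ → Set (suc ℓ)
  IsCompact K = ∀ (I : Set ℓ) (U : I → Pred Carrier ℓ) → (∀ i → IsOpen (U i)) →
    K ⊆ ⋃ I U → Σ[ n ∈ ℕ ] Σ[ f ∈ (Fin n → I) ] (K ⊆ ⋃ (Fin n) (λ k → U (f k)))

  LocallyCompact : Set (suc ℓ)
  LocallyCompact = ∀ (x : Carrier) →
    Σ[ U ∈ Pred Carrier ℓ ] Σ[ K ∈ Pred Carrier ℓ ]
      (IsOpen U × x ∈ U × U ⊆ K × IsCompact K)

  ClosedDiscrete : Pred Carrier ℓ → Set (suc ℓ)
  ClosedDiscrete D = IsClosed D ×
    (∀ d → d ∈ D → Σ[ U ∈ Pred Carrier ℓ ]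
       (IsOpen U × d ∈ U × (∀ y → y ∈ U → y ∈ D → y ≡ d)))

  CollectionwiseHausdorff : Set (suc ℓ)
  CollectionwiseHausdorff = ∀ (D : Pred Carrier ℓ) → ClosedDiscrete D →
    Σ[ U ∈ (Σ Carrier D → Pred Carrier ℓ) ]
      ((∀ d → IsOpen (U d)) × (∀ d → proj₁ d ∈ U d) ×
       (∀ d e x → x ∈ U d → x ∈ U e → proj₁ d ≡ proj₁ e))

  DiscreteFamily : {I : Set ℓ} → (I → Pred Carrier ℓ) → Set (suc ℓ)
  DiscreteFamily {I} K = ∀ (x : Carrier) → Σ[ U ∈ Pred Carrier ℓ ]
    (IsOpen U × x ∈ U ×
     (∀ i j → (∃[ y ] (y ∈ U × y ∈ K i)) → (∃[ z ] (z ∈ U × z ∈ K j)) → i ≡ j))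

  CWNCompact : Set (suc ℓ)
  CWNCompact = ∀ (I : Set ℓ) (K : I → Pred Carrier ℓ) →
    (∀ i → IsCompact (K i)) → DiscreteFamily K →
    Σ[ U ∈ (I → Pred Carrier ℓ) ]
      ((∀ i → IsOpen (U i)) × (∀ i → K i ⊆ U i) ×
       (∀ i j x → x ∈ U i → x ∈ U j → i ≡ j))

module Submission where

-- Let K = (K i)ᵢ be a discrete family of compact sets in a locally compact,
-- perfectly normal space X.  Collapse every K i to a single point: the
-- quotient Y has carrier X ⊎ I, and q : X → Y sends points of K i to inj₂ i
-- and all other points to themselves.  The quotient map q is closed with
-- compact fibres, i.e. perfect, so Y is again locally compact and perfectly
-- normal.  The collapsed points form a closed discrete subset of Y; by the
-- hypothesis Y is collectionwise Hausdorff, and pulling the separating open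
-- sets back along q separates the family K.

open import Defs
open import Level using (Level; Lift; lift; lower) renaming (suc to lsuc)
open import Axiom.ExcludedMiddle using (ExcludedMiddle)
open import Axiom.DoubleNegationElimination using (em⇒dne)
open import Data.Nat using (ℕ; zero; suc; _+_)
open import Data.Fin using (Fin; zero; suc; splitAt; _↑ˡ_; _↑ʳ_)
open import Data.Fin.Properties using (splitAt-↑ˡ; splitAt-↑ʳ)
open import Data.Product using (Σ; Σ-syntax; _×_; _,_; proj₁; proj₂)
open import Data.Sum using (_⊎_; inj₁; inj₂; [_,_])
open import Data.Sum.Properties using (inj₂-injective)
open import Data.Unit.Polymorphic using (⊤; tt)
open import Data.Empty using (⊥; ⊥-elim)
import Data.Empty.Polymorphic as Poly
open import Relation.Nullary using (Dec; yes; no; ¬_)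
open import Relation.Binary.PropositionalEquality using (_≡_; refl; sym; trans; cong; subst)
open import Relation.Unary using (Pred; _∈_; _⊆_; _≐_; ∁; _∩_; ⋃; ⋂)

module Basics {ℓ : Level} (X : Space ℓ) where
  open Space X

  ∁-≐ : {A B : Pred Carrier ℓ} → A ≐ B → ∁ A ≐ ∁ B
  ∁-≐ (A⊆B , B⊆A) = (λ ¬a b → ¬a (B⊆A b)) , (λ ¬b a → ¬b (A⊆B a))

  closed-≐ : {A B : Pred Carrier ℓ} → A ≐ B → IsClosed X A → IsClosed X B
  closed-≐ A≐B = open-≐ (∁-≐ A≐B)

  compact-≐ : {A B : Pred Carrier ℓ} → A ≐ B → IsCompact X A → IsCompact X B
  compact-≐ (A⊆B , B⊆A) compactA I U open-U B⊆⋃U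
    with compactA I U open-U (λ a → B⊆⋃U (A⊆B a))
  ... | n , f , A⊆⋃Uf = n , f , (λ b → A⊆⋃Uf (B⊆A b))

  open-locally : (S : Pred Carrier ℓ) →
    (∀ {x} → S x → Σ[ N ∈ Pred Carrier ℓ ] (IsOpen N × N x × N ⊆ S)) → IsOpen S
  open-locally S nbhd = open-≐ (inside , covers) (open-⋃ N (λ p → proj₁ (proj₂ (nbhd (proj₂ p)))))
    where
      N : Σ Carrier S → Pred Carrier ℓ
      N p = proj₁ (nbhd (proj₂ p))
      inside : ⋃ (Σ Carrier S) N ⊆ S
      inside ((_ , s) , n) = proj₂ (proj₂ (proj₂ (nbhd s))) n
      covers : S ⊆ ⋃ (Σ Carrier S) N
      covers s = (_ , s) , proj₁ (proj₂ (proj₂ (nbhd s)))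

  open-⋂-Fin : (n : ℕ) (U : Fin n → Pred Carrier ℓ) → (∀ k → IsOpen (U k)) →
    IsOpen (λ x → ∀ k → U k x)
  open-⋂-Fin zero U _ = open-≐ ((λ _ ()) , (λ _ → tt)) open-univ
  open-⋂-Fin (suc n) U open-U =
    open-≐ (join , split) (open-∩ (open-U zero) (open-⋂-Fin n (λ k → U (suc k)) (λ k → open-U (suc k))))
    where
      join : (U zero ∩ (λ x → ∀ k → U (suc k) x)) ⊆ (λ x → ∀ k → U k x)
      join (u , _) zero = u
      join (_ , us) (suc k) = us k
      split : (λ x → ∀ k → U k x) ⊆ (U zero ∩ (λ x → ∀ k → U (suc k) x))
      split us = us zero , (λ k → us (suc k))

  compact-∪ : ∀ {A B : Pred Carrier ℓ} → IsCompact X A → IsCompact X B →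
    IsCompact X (λ x → A x ⊎ B x)
  compact-∪ {A} {B} compactA compactB I U open-U cover
    with compactA I U open-U (λ a → cover (inj₁ a)) | compactB I U open-U (λ b → cover (inj₂ b))
  ... | n , f , A⊆ | m , g , B⊆ = n + m , h , A∪B⊆
    where
      h : Fin (n + m) → I
      h k = [ f , g ] (splitAt n k)
      A∪B⊆ : (λ x → A x ⊎ B x) ⊆ ⋃ (Fin (n + m)) (λ k → U (h k))
      A∪B⊆ {x} (inj₁ a) with A⊆ a
      ... | k , u = k ↑ˡ m , subst (λ i → U i x) (sym (cong [ f , g ] (splitAt-↑ˡ n k m))) u
      A∪B⊆ {x} (inj₂ b) with B⊆ b
      ... | k , u = n ↑ʳ k , subst (λ i → U i x) (sym (cong [ f , g ] (splitAt-↑ʳ n m k))) u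

  compact-⋃-Fin : (n : ℕ) (C : Fin n → Pred Carrier ℓ) → (∀ k → IsCompact X (C k)) →
    IsCompact X (λ x → Σ (Fin n) (λ k → C k x))
  compact-⋃-Fin zero C _ I U open-U cover = 0 , (λ ()) , (λ { (() , _) })
  compact-⋃-Fin (suc n) C compactC =
    compact-≐ (merge , unmerge)
      (compact-∪ (compactC zero) (compact-⋃-Fin n (λ k → C (suc k)) (λ k → compactC (suc k))))
    where
      merge : (λ x → C zero x ⊎ Σ (Fin n) (λ k → C (suc k) x)) ⊆ (λ x → Σ (Fin (suc n)) (λ k → C k x))
      merge (inj₁ c) = zero , c
      merge (inj₂ (k , c)) = suc k , c
      unmerge : (λ x → Σ (Fin (suc n)) (λ k → C k x)) ⊆ (λ x → C zero x ⊎ Σ (Fin n) (λ k → C (suc k) x))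
      unmerge (zero , c) = inj₁ c
      unmerge (suc k , c) = inj₂ (k , c)

  compact-point : (x₀ : Carrier) → IsCompact X (λ z → z ≡ x₀)
  compact-point x₀ I U open-U cover with cover refl
  ... | i , u = 1 , (λ _ → i) , (λ { refl → zero , u })

  -- In a locally compact space every compact set lies in the interior of a
  -- compact set: finitely many compact neighbourhoods of its points suffice.
  compact-neighbourhood : LocallyCompact X → {C : Pred Carrier ℓ} → IsCompact X C →
    Σ[ W ∈ Pred Carrier ℓ ] Σ[ L ∈ Pred Carrier ℓ ] (IsOpen W × C ⊆ W × W ⊆ L × IsCompact X L)
  compact-neighbourhood lc {C} compactC = enlarge (compactC (Σ Carrier C) U open-U covered)
    where
      U L : Σ Carrier C → Pred Carrier ℓ
      U p = proj₁ (lc (proj₁ p))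
      L p = proj₁ (proj₂ (lc (proj₁ p)))
      open-U : ∀ p → IsOpen (U p)
      open-U p = proj₁ (proj₂ (proj₂ (lc (proj₁ p))))
      U⊆L : ∀ p → U p ⊆ L p
      U⊆L p = proj₁ (proj₂ (proj₂ (proj₂ (proj₂ (lc (proj₁ p))))))
      compact-L : ∀ p → IsCompact X (L p)
      compact-L p = proj₂ (proj₂ (proj₂ (proj₂ (proj₂ (lc (proj₁ p))))))
      covered : C ⊆ ⋃ (Σ Carrier C) U
      covered {x} c = (x , c) , proj₁ (proj₂ (proj₂ (proj₂ (lc x))))
      enlarge : Σ[ n ∈ ℕ ] Σ[ f ∈ (Fin n → Σ Carrier C) ] (C ⊆ ⋃ (Fin n) (λ k → U (f k))) →
        Σ[ W ∈ Pred Carrier ℓ ] Σ[ L′ ∈ Pred Carrier ℓ ] (IsOpen W × C ⊆ W × W ⊆ L′ × IsCompact X L′)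
      enlarge (n , f , C⊆) =
        ⋃ (Lift ℓ (Fin n)) (λ k → U (f (lower k))) ,
        (λ x → Σ (Fin n) (λ k → L (f k) x)) ,
        open-⋃ _ (λ k → open-U (f (lower k))) ,
        (λ c → let (k , u) = C⊆ c in lift k , u) ,
        (λ { (lift k , u) → k , U⊆L (f k) u }) ,
        compact-⋃-Fin n (λ k → L (f k)) (λ k → compact-L (f k))

  record Separation (x y : Carrier) : Set (lsuc ℓ) where
    field
      nbhdˣ nbhdʸ : Pred Carrier ℓ
      open-nbhdˣ  : IsOpen nbhdˣ
      open-nbhdʸ  : IsOpen nbhdʸ
      x∈nbhdˣ     : nbhdˣ x
      y∈nbhdʸ     : nbhdʸ y
      disjoint    : ∀ z → nbhdˣ z → nbhdʸ z → ⊥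

  Hausdorff : Set (lsuc ℓ)
  Hausdorff = ∀ x y → ¬ x ≡ y → Separation x y

  normal⇒hausdorff : Normal X → Hausdorff
  normal⇒hausdorff (points-closed , separate) x y x≢y
    with separate (λ z → z ≡ x) (λ z → z ≡ y) (points-closed x) (points-closed y)
                  (λ z z≡x z≡y → x≢y (trans (sym z≡x) z≡y))
  ... | U , V , open-U , open-V , x⊆U , y⊆V , U∩V=∅ =
    record { nbhdˣ = U ; nbhdʸ = V ; open-nbhdˣ = open-U ; open-nbhdʸ = open-V
           ; x∈nbhdˣ = x⊆U refl ; y∈nbhdʸ = y⊆V refl ; disjoint = U∩V=∅ }

  -- Compact subsets of a Hausdorff space are closed: for x ∉ C, cover C by
  -- neighbourhoods separated from x; the finitely many corresponding
  -- neighbourhoods of x intersect in a neighbourhood missing C.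
  compact⇒closed : Hausdorff → {C : Pred Carrier ℓ} → IsCompact X C → IsClosed X C
  compact⇒closed hausdorff {C} compactC = open-locally (∁ C) nbhd-outside
    where
      nbhd-outside : ∀ {x} → ¬ C x → Σ[ N ∈ Pred Carrier ℓ ] (IsOpen N × N x × N ⊆ ∁ C)
      nbhd-outside {x} x∉C = avoid (compactC (Σ Carrier C) V (λ p → open-nbhdʸ (sep p)) covered)
        where
          open Separation
          sep : (p : Σ Carrier C) → Separation x (proj₁ p)
          sep (y , c) = hausdorff x y (λ { refl → x∉C c })
          V : Σ Carrier C → Pred Carrier ℓ
          V p = nbhdʸ (sep p)
          covered : C ⊆ ⋃ (Σ Carrier C) V
          covered {y} c = (y , c) , y∈nbhdʸ (sep (y , c))
          avoid : Σ[ n ∈ ℕ ] Σ[ f ∈ (Fin n → Σ Carrier C) ] (C ⊆ ⋃ (Fin n) (λ k → V (f k))) →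
            Σ[ N ∈ Pred Carrier ℓ ] (IsOpen N × N x × N ⊆ ∁ C)
          avoid (n , f , C⊆) =
            (λ z → ∀ k → nbhdˣ (sep (f k)) z) ,
            open-⋂-Fin n _ (λ k → open-nbhdˣ (sep (f k))) ,
            (λ k → x∈nbhdˣ (sep (f k))) ,
            (λ {z} z∈N c → let (k , v) = C⊆ c in disjoint (sep (f k)) z (z∈N k) v)

module DiscreteFamilies {ℓ : Level} (lem : ExcludedMiddle ℓ) (X : Space ℓ)
                        {I : Set ℓ} (K : I → Pred (Space.Carrier X) ℓ)
                        (discreteK : DiscreteFamily X K) where
  open Space X
  open Basics X

  members-disjoint : ∀ {i j x} → K i x → K j x → i ≡ j
  members-disjoint {i} {j} {x} kᵢ kⱼ = meets-one i j (x , x∈U , kᵢ) (x , x∈U , kⱼ)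
    where
      x∈U = proj₁ (proj₂ (proj₂ (discreteK x)))
      meets-one = proj₂ (proj₂ (proj₂ (discreteK x)))

  UnionOf : (P : I → Set ℓ) → Pred Carrier ℓ
  UnionOf P x = Σ[ i ∈ I ] (P i × K i x)

  -- A union of members of a discrete family of closed sets is closed: a point
  -- outside it has a neighbourhood meeting at most one member, and removing
  -- that (closed) member leaves a neighbourhood missing the union.
  UnionOf-closed : (∀ i → IsClosed X (K i)) → (P : I → Set ℓ) → IsClosed X (UnionOf P)
  UnionOf-closed closedK P = open-locally (∁ (UnionOf P)) nbhd-outside
    where
      nbhd-outside : ∀ {x} → ¬ UnionOf P x →
        Σ[ N ∈ Pred Carrier ℓ ] (IsOpen N × N x × N ⊆ ∁ (UnionOf P))
      nbhd-outside {x} x∉ with discreteK x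
      ... | U , open-U , x∈U , meets-one
        with lem {Σ[ j ∈ I ] (P j × Σ[ y ∈ Carrier ] (U y × K j y))}
      ... | no U-misses = U , open-U , x∈U , (λ { {z} z∈U (i , pᵢ , kᵢ) → U-misses (i , pᵢ , z , z∈U , kᵢ) })
      ... | yes (j , pⱼ , y , y∈U , kⱼ) =
            (U ∩ ∁ (K j)) , open-∩ open-U (closedK j) , (x∈U , (λ k → x∉ (j , pⱼ , k))) ,
            (λ { {z} (z∈U , z∉Kⱼ) (i , _ , kᵢ) →
                   z∉Kⱼ (subst (λ i′ → K i′ z) (meets-one i j (z , z∈U , kᵢ) (y , y∈U , kⱼ)) kᵢ) })

module QuotientSpace {ℓ : Level} (X : Space ℓ) {Y₀ : Set ℓ} (q : Space.Carrier X → Y₀) where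
  open Space X

  quotient : Space ℓ
  quotient = record
    { Carrier   = Y₀
    ; IsOpen    = λ V → IsOpen (λ x → V (q x))
    ; open-≐    = λ { (V⊆W , W⊆V) → open-≐ (V⊆W , W⊆V) }
    ; open-univ = open-univ
    ; open-∩    = open-∩
    ; open-⋃    = λ V → open-⋃ (λ i x → V i (q x))
    }

  Saturated : Pred Carrier ℓ → Set ℓ
  Saturated S = ∀ {x z} → q x ≡ q z → S x → S z

  -- Every open set has a largest saturated open subset W °; this is the
  -- statement that q is a closed map onto the quotient.
  record SaturatedInteriors : Set (lsuc ℓ) where
    field
      _°          : Pred Carrier ℓ → Pred Carrier ℓ
      °-open      : ∀ {W} → IsOpen W → IsOpen (W °)
      °-⊆         : ∀ {W} → W ° ⊆ W
      °-saturated : ∀ W → Saturated (W °)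
      °-largest   : ∀ {S W} → Saturated S → S ⊆ W → S ⊆ W °

  compact-image : {L : Pred Carrier ℓ} → IsCompact X L →
    IsCompact quotient (λ y → Σ[ x ∈ Carrier ] (q x ≡ y × L x))
  compact-image compactL J V open-V cover
    with compactL J (λ j x → V j (q x)) open-V (λ {x} l → cover (x , refl , l))
  ... | n , f , L⊆ = n , f , (λ { (x , refl , l) → L⊆ l })

module ClosedQuotient {ℓ : Level} (X : Space ℓ) {Y₀ : Set ℓ} (q : Space.Carrier X → Y₀)
                      (interiors : QuotientSpace.SaturatedInteriors X q) where
  open Space X
  open QuotientSpace X q
  open SaturatedInteriors interiors
  open Basics X using (compact-neighbourhood)
  module Q = Space quotient

  -- If W is an open
  -- set containing q⁻¹ S, this is an open set of the quotient containing S,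
  -- whose preimage is contained in W outside q⁻¹ S.
  extend : Pred Y₀ ℓ → Pred Carrier ℓ → Pred Y₀ ℓ
  extend S W y = S y ⊎ Σ[ x ∈ Carrier ] (q x ≡ y × (W °) x)

  extend-open : ∀ {S W} → IsOpen W → (∀ {x} → S (q x) → W x) → Q.IsOpen (extend S W)
  extend-open {S} {W} open-W q⁻¹S⊆W = open-≐ (image , preimage) (°-open open-W)
    where
      image : (W °) ⊆ (λ x → extend S W (q x))
      image {x} w = inj₂ (x , refl , w)
      preimage : (λ x → extend S W (q x)) ⊆ (W °)
      preimage (inj₁ s) = °-largest (λ e s → subst S e s) q⁻¹S⊆W s
      preimage (inj₂ (_ , e , w)) = °-saturated W e w

  -- Normality passes to the quotient: separate the preimages in X and extend.
  quotient-normal : Normal X → (∀ y → IsClosed X (λ x → q x ≡ y)) → Normal quotient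
  quotient-normal (_ , separate) fibres-closed = fibres-closed , separateY
    where
      separateY : ∀ (A B : Pred Y₀ ℓ) → IsClosed quotient A → IsClosed quotient B →
        (∀ y → y ∈ A → y ∈ B → ⊥) →
        Σ[ U ∈ Pred Y₀ ℓ ] Σ[ V ∈ Pred Y₀ ℓ ]
          (Q.IsOpen U × Q.IsOpen V × A ⊆ U × B ⊆ V × (∀ y → y ∈ U → y ∈ V → ⊥))
      separateY A B closedA closedB A∩B=∅
        with separate (λ x → A (q x)) (λ x → B (q x)) closedA closedB (λ x → A∩B=∅ (q x))
      ... | U , V , open-U , open-V , A⊆U , B⊆V , U∩V=∅ =
            extend A U , extend B V , extend-open {S = A} open-U A⊆U , extend-open {S = B} open-V B⊆V ,
            inj₁ , inj₁ , disjoint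
        where
          disjoint : ∀ y → extend A U y → extend B V y → ⊥
          disjoint y (inj₁ a) (inj₁ b) = A∩B=∅ y a b
          disjoint y (inj₁ a) (inj₂ (x , e , v)) = U∩V=∅ x (A⊆U (subst A (sym e) a)) (°-⊆ v)
          disjoint y (inj₂ (x , e , u)) (inj₁ b) = U∩V=∅ x (°-⊆ u) (B⊆V (subst B (sym e) b))
          disjoint y (inj₂ (x , e , u)) (inj₂ (x′ , e′ , v)) =
            U∩V=∅ x (°-⊆ u) (°-⊆ (°-saturated V (trans e′ (sym e)) v))

  -- Closed sets stay G_δ: extend each open set of a G_δ representation of the
  -- preimage.  A point of the intersection outside F would come from a point x
  -- lying in all those open sets, hence in q⁻¹ F.
  quotient-Gδ : ExcludedMiddle ℓ → ClosedGδ X → ClosedGδ quotient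
  quotient-Gδ lem gδ F closedF with gδ (λ x → F (q x)) closedF
  ... | U , open-U , (q⁻¹F⊆⋂U , ⋂U⊆q⁻¹F) =
        (λ n → extend F (U n)) , (λ n → extend-open {S = F} (open-U n) (λ f → q⁻¹F⊆⋂U f n)) ,
        ((λ f n → inj₁ f) , ⋂⊆F)
    where
      ⋂⊆F : ⋂ ℕ (λ n → extend F (U n)) ⊆ F
      ⋂⊆F {y} y∈⋂ with lem {F y}
      ... | yes f = f
      ... | no y∉F with y∈⋂ 0
      ...   | inj₁ f = ⊥-elim (y∉F f)
      ...   | inj₂ (x , qx≡y , _) = subst F qx≡y (⋂U⊆q⁻¹F x∈⋂U)
        where
          x∈⋂U : ∀ n → U n x
          x∈⋂U n with y∈⋂ n
          ... | inj₁ f = ⊥-elim (y∉F f)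
          ... | inj₂ (_ , e , w) = °-⊆ (°-saturated (U n) (trans e (sym qx≡y)) w)

  -- Local compactness passes to the quotient when fibres are compact: a compact
  -- neighbourhood of the fibre over y maps to a compact neighbourhood of y.
  quotient-locallyCompact : LocallyCompact X → (∀ y → IsCompact X (λ x → q x ≡ y)) →
    LocallyCompact quotient
  quotient-locallyCompact lc fibres-compact y
    with compact-neighbourhood lc (fibres-compact y)
  ... | W , L , open-W , fibre⊆W , W⊆L , compact-L =
        extend (_≡ y) W , Lʸ , extend-open {S = _≡ y} open-W fibre⊆W , inj₁ refl , W⊆Lʸ ,
        compact-∪ (compact-point y) (compact-image compact-L)
    where
      open Basics quotient using (compact-∪; compact-point)
      Lʸ : Pred Y₀ ℓ
      Lʸ y′ = (y′ ≡ y) ⊎ Σ[ x ∈ Carrier ] (q x ≡ y′ × L x)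
      W⊆Lʸ : extend (_≡ y) W ⊆ Lʸ
      W⊆Lʸ (inj₁ e) = inj₁ e
      W⊆Lʸ (inj₂ (x , e , w)) = inj₂ (x , e , W⊆L (°-⊆ w))

module Collapse {ℓ : Level} (lem : ExcludedMiddle ℓ) (X : Space ℓ) (normal : Normal X)
                {I : Set ℓ} (K : I → Pred (Space.Carrier X) ℓ)
                (compactK : ∀ i → IsCompact X (K i)) (discreteK : DiscreteFamily X K) where
  open Space X
  open Basics X
  open DiscreteFamilies lem X K discreteK

  closedK : ∀ i → IsClosed X (K i)
  closedK i = compact⇒closed (normal⇒hausdorff normal) (compactK i)

  InMember : Pred Carrier ℓ
  InMember x = Σ[ i ∈ I ] K i x

  q : Carrier → Carrier ⊎ I
  q x with lem {InMember x}
  ... | yes (i , _) = inj₂ i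
  ... | no _ = inj₁ x

  q-member : ∀ {i x} → K i x → q x ≡ inj₂ i
  q-member {i} {x} kᵢ with lem {InMember x}
  ... | yes (j , kⱼ) = cong inj₂ (members-disjoint kⱼ kᵢ)
  ... | no x∉ = ⊥-elim (x∉ (i , kᵢ))

  q-nonmember : ∀ {x} → ¬ InMember x → q x ≡ inj₁ x
  q-nonmember {x} x∉ with lem {InMember x}
  ... | yes x∈ = ⊥-elim (x∉ x∈)
  ... | no _ = refl

  q-collapsed : ∀ {x i} → q x ≡ inj₂ i → K i x
  q-collapsed {x} e with lem {InMember x}
  q-collapsed {x} e | yes (j , kⱼ) = subst (λ j → K j x) (inj₂-injective e) kⱼ
  q-collapsed {x} () | no _

  q-kept : ∀ {x x₀} → q x ≡ inj₁ x₀ → (x ≡ x₀) × ¬ InMember x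
  q-kept {x} e with lem {InMember x}
  q-kept {x} () | yes _
  q-kept {x} refl | no x∉ = refl , x∉

  open QuotientSpace X q

  -- The largest saturated open subset of W: remove from W all members not
  -- contained in W (a closed set, by discreteness).
  interiors : SaturatedInteriors
  interiors = record
    { _°          = _°
    ; °-open      = λ {W} open-W → open-∩ open-W (UnionOf-closed closedK (λ i → ¬ (K i ⊆ W)))
    ; °-⊆         = proj₁
    ; °-saturated = °-saturated
    ; °-largest   = °-largest
    }
    where
      _° : Pred Carrier ℓ → Pred Carrier ℓ
      (W °) x = W x × ¬ UnionOf (λ i → ¬ (K i ⊆ W)) x

      °-saturated : ∀ W → Saturated (W °)
      °-saturated W {x} {z} qx≡qz (w , x∉) = by-membership (lem {InMember x})
        where
          by-membership : Dec (InMember x) → (W °) z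
          by-membership (no x∉K) =
            subst (W °) (sym (proj₁ (q-kept (trans (sym qx≡qz) (q-nonmember x∉K))))) (w , x∉)
          by-membership (yes (i , kᵢx)) = Kᵢ⊆W kᵢz , z∉
            where
              Kᵢ⊆W : K i ⊆ W
              Kᵢ⊆W = em⇒dne lem (λ Kᵢ⊈W → x∉ (i , Kᵢ⊈W , kᵢx))
              kᵢz : K i z
              kᵢz = q-collapsed (trans (sym qx≡qz) (q-member kᵢx))
              z∉ : ¬ UnionOf (λ i → ¬ (K i ⊆ W)) z
              z∉ (j , Kⱼ⊈W , kⱼz) = Kⱼ⊈W (subst (λ j → K j ⊆ W) (members-disjoint kᵢz kⱼz) Kᵢ⊆W)

      °-largest : ∀ {S W} → Saturated S → S ⊆ W → S ⊆ W °
      °-largest saturated S⊆W s =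
        S⊆W s , λ { (i , Kᵢ⊈W , kᵢx) →
          Kᵢ⊈W (λ kᵢy → S⊆W (saturated (trans (q-member kᵢx) (sym (q-member kᵢy))) s)) }

  open ClosedQuotient X q interiors

  Y : Space ℓ
  Y = quotient

  kept-fibre : ∀ {x₀} → ¬ InMember x₀ → (λ x → x ≡ x₀) ≐ (λ x → q x ≡ inj₁ x₀)
  kept-fibre x₀∉ = (λ { refl → q-nonmember x₀∉ }) , (λ e → proj₁ (q-kept e))

  empty-fibre : ∀ {x₀} → InMember x₀ → ∀ {x} → ¬ q x ≡ inj₁ x₀
  empty-fibre x₀∈ e with q-kept e
  ... | refl , x₀∉ = x₀∉ x₀∈

  fibre-closed : ∀ y → IsClosed X (λ x → q x ≡ y)
  fibre-closed (inj₂ i) = closed-≐ (q-member , q-collapsed) (closedK i)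
  fibre-closed (inj₁ x₀) with lem {InMember x₀}
  ... | yes x₀∈ = open-≐ ((λ _ → empty-fibre x₀∈) , (λ _ → tt)) open-univ
  ... | no x₀∉ = closed-≐ (kept-fibre x₀∉) (proj₁ normal x₀)

  fibre-compact : ∀ y → IsCompact X (λ x → q x ≡ y)
  fibre-compact (inj₂ i) = compact-≐ (q-member , q-collapsed) (compactK i)
  fibre-compact (inj₁ x₀) with lem {InMember x₀}
  ... | yes x₀∈ = λ _ _ _ _ → 0 , (λ ()) , (λ e → ⊥-elim (empty-fibre x₀∈ e))
  ... | no x₀∉ = compact-≐ (kept-fibre x₀∉) (compact-point x₀)

  Y-perfectlyNormal : PerfectlyNormal X → PerfectlyNormal Y
  Y-perfectlyNormal (normalX , gδX) = quotient-normal normalX fibre-closed , quotient-Gδ lem gδX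

  Y-locallyCompact : LocallyCompact X → LocallyCompact Y
  Y-locallyCompact lc = quotient-locallyCompact lc fibre-compact

  Collapsed : Pred (Carrier ⊎ I) ℓ
  Collapsed (inj₁ _) = Poly.⊥
  Collapsed (inj₂ _) = ⊤

  -- Their preimage is the closed set ⋃ K; the collapsed point inj₂ i is
  -- isolated among them by the image of the complement of the other members.
  collapsed-closedDiscrete : ClosedDiscrete Y Collapsed
  collapsed-closedDiscrete = closed , isolated
    where
      closed : IsClosed Y Collapsed
      closed = closed-≐ (to , from) (UnionOf-closed closedK (λ _ → ⊤))
        where
          to : UnionOf (λ _ → ⊤) ⊆ (λ x → Collapsed (q x))
          to (_ , _ , kᵢ) = subst Collapsed (sym (q-member kᵢ)) tt
          from : (λ x → Collapsed (q x)) ⊆ UnionOf (λ _ → ⊤)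
          from {x} c with q x in qx≡ | c
          ... | inj₁ _ | lift ()
          ... | inj₂ i | _ = i , tt , q-collapsed qx≡
      isolated : ∀ d → d ∈ Collapsed → Σ[ U ∈ Pred (Carrier ⊎ I) ℓ ]
        (Space.IsOpen Y U × d ∈ U × (∀ y → y ∈ U → y ∈ Collapsed → y ≡ d))
      isolated (inj₂ i) _ =
        extend (_≡ inj₂ i) others-missed ,
        extend-open {S = _≡ inj₂ i} (UnionOf-closed closedK (λ j → ¬ j ≡ i)) fibre⊆ , inj₁ refl , only
        where
          others-missed : Pred Carrier ℓ
          others-missed = ∁ (UnionOf (λ j → ¬ j ≡ i))
          fibre⊆ : ∀ {x} → q x ≡ inj₂ i → others-missed x
          fibre⊆ e (j , j≢i , kⱼ) = j≢i (members-disjoint kⱼ (q-collapsed e))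
          only : ∀ y → extend (_≡ inj₂ i) others-missed y → Collapsed y → y ≡ inj₂ i
          only y (inj₁ e) _ = e
          only (inj₂ j) (inj₂ (x , e , w)) _ =
            cong inj₂ (em⇒dne lem (λ j≢i → proj₁ w (j , j≢i , q-collapsed e)))

  separate-family : CollectionwiseHausdorff Y → Σ[ U ∈ (I → Pred Carrier ℓ) ]
    ((∀ i → IsOpen (U i)) × (∀ i → K i ⊆ U i) × (∀ i j x → x ∈ U i → x ∈ U j → i ≡ j))
  separate-family cwh with cwh Collapsed collapsed-closedDiscrete
  ... | V , open-V , d∈V , disjoint =
        (λ i x → V (inj₂ i , tt) (q x)) , (λ i → open-V (inj₂ i , tt)) ,
        (λ i kᵢ → subst (V (inj₂ i , tt)) (sym (q-member kᵢ)) (d∈V (inj₂ i , tt))) ,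
        (λ i j x u v → inj₂-injective (disjoint (inj₂ i , tt) (inj₂ j , tt) (q x) u v))

lemma2p6 : ∀ {ℓ : Level} → ExcludedMiddle ℓ →
    (∀ (X : Space ℓ) → LocallyCompact X → PerfectlyNormal X → CollectionwiseHausdorff X) →
    ∀ (X : Space ℓ) → LocallyCompact X → PerfectlyNormal X → CWNCompact X
lemma2p6 lem cwh X lc pn I K compactK discreteK =
  separate-family (cwh Y (Y-locallyCompact lc) (Y-perfectlyNormal pn))
  where open Collapse lem X (proj₁ pn) K compactK discreteK
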